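{- Let $G$ be a finite group with a minimal normal subgroup $W$ with $|W|=m$. Suppose $G$ is isomorphic to a quotient of a group $H$, where $H$ is a subgroup of a direct product $H_1\times\cdots\times H_s$ of finite groups. Then $|H_i|\ge m$ for some index $i\in\{1,\dots,s\}$. -}

module Defs where

open import Data.Nat using (ℕ)
open import Data.Fin using (Fin)
open import Data.Fin.Subset using (Subset; _∈_; _⊆_)
open import Data.Product using (∃; _×_)
open import Data.Sum using (_⊎_)
open import Relation.Binary.PropositionalEquality using (_≡_; _≢_)

-- A finite group, presented (up to isomorphism) on the carrier Fin order.
record FinGroup : Set where
  field
    order  : ℕ
    _∙_    : Fin order → Fin order → Fin order
    ε      : Fin order
    _⁻¹    : Fin order → Fin order
    assoc  : ∀ x y z → (x ∙ y) ∙ z ≡ x ∙ (y ∙ z)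
    identityˡ : ∀ x → ε ∙ x ≡ x
    identityʳ : ∀ x → x ∙ ε ≡ x
    inverseˡ  : ∀ x → (x ⁻¹) ∙ x ≡ ε
    inverseʳ  : ∀ x → x ∙ (x ⁻¹) ≡ ε

  Carrier : Set
  Carrier = Fin order

open FinGroup public using (order; Carrier)

module _ (G : FinGroup) where
  open FinGroup G hiding (order; Carrier)

  IsSubgroup : Subset (order G) → Set
  IsSubgroup S = (ε ∈ S)
               × (∀ x y → x ∈ S → y ∈ S → (x ∙ y) ∈ S)
               × (∀ x → x ∈ S → (x ⁻¹) ∈ S)

  IsNormalSubgroup : Subset (order G) → Set
  IsNormalSubgroup N = IsSubgroup N × (∀ g x → x ∈ N → ((g ∙ x) ∙ (g ⁻¹)) ∈ N)

  IsTrivial : Subset (order G) → Set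
  IsTrivial N = ∀ x → x ∈ N → x ≡ ε

  IsMinimalNormal : Subset (order G) → Set
  IsMinimalNormal W = IsNormalSubgroup W
                    × (∃ λ w → w ∈ W × w ≢ ε)
                    × (∀ N → IsNormalSubgroup N → N ⊆ W → IsTrivial N ⊎ W ⊆ N)

IsHom : (H G : FinGroup) → (Carrier H → Carrier G) → Set
IsHom H G f = ∀ x y → f (FinGroup._∙_ H x y) ≡ FinGroup._∙_ G (f x) (f y)

Surjective : {A B : Set} → (A → B) → Set
Surjective {A} {B} f = ∀ b → ∃ λ a → f a ≡ b

-- The direct product H₁ × ⋯ × Hₛ has elements (i : Fin s) → Carrier (Hs i),
-- with componentwise multiplication.  A map ι : H → ∏ Hs is a homomorphism
-- iff each component ι · i is, and it is injective iff the family separates points.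
IsEmbeddingIntoProduct : (H : FinGroup) (s : ℕ) (Hs : Fin s → FinGroup)
  → ((x : Carrier H) → (i : Fin s) → Carrier (Hs i)) → Set
IsEmbeddingIntoProduct H s Hs ι =
    (∀ i → IsHom H (Hs i) (λ x → ι x i))
  × (∀ x y → (∀ i → ι x i ≡ ι y i) → x ≡ y)

module Submission where

-- Let Kⱼ ⊴ H be the kernel of the projection onto the first j factors,
-- so K₀ = H and Kₛ = 1.  The images W[j] = π(Kⱼ ∩ π⁻¹W) are normal subgroups
-- of G contained in W (π is surjective), so by minimality each is trivial or
-- all of W.  Since W[0] = W and W[s] = 1, there is a j < s with W[j] = W and
-- W[j+1] = 1.  Choosing for every w ∈ W a preimage xʷ ∈ Kⱼ, the map
-- w ↦ ι(xʷ)ⱼ ∈ Hⱼ is injective: if two codes agree then xʷ(xᵛ)⁻¹ ∈ Kⱼ₊₁, so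
-- w v⁻¹ ∈ W[j+1] = 1.  Hence |W| ≤ |Hⱼ|.

open import Defs
open import Level using (0ℓ)
open import Algebra.Bundles using (Group)
import Algebra.Properties.Group
open import Data.Nat using (ℕ; zero; suc; _≤_; _<_; z≤n; s≤s; _<?_)
open import Data.Nat.Properties using (m<1+n⇒m<n∨m≡n)
open import Data.Fin using (Fin; toℕ; fromℕ<; punchOut) renaming (zero to fzero; suc to fsuc)
open import Data.Fin.Properties using (any?; all?; toℕ<n; toℕ-fromℕ<; toℕ-injective; suc-injective; punchOut-injective; 0≢1+n) renaming (_≟_ to _≟ᶠ_)
open import Data.Fin.Subset using (Subset; ∣_∣; _∈_; _⊆_; inside; outside)
open import Data.Fin.Subset.Properties using (_∈?_)
open import Data.Vec using (tabulate; here; there; _∷_; [])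
open import Data.Vec.Properties using (lookup∘tabulate; []=⇒lookup; lookup⇒[]=)
open import Data.Product using (∃; _×_; _,_; proj₁; proj₂)
open import Data.Sum using (_⊎_; inj₁; inj₂)
open import Data.Empty using (⊥-elim)
open import Function using (_∘_)
open import Relation.Nullary using (yes; no; does; ¬_)
open import Relation.Nullary.Decidable using (dec-true; _×-dec_; _→-dec_)
open import Relation.Unary using (Decidable)
open import Relation.Binary.PropositionalEquality using (_≡_; refl; sym; trans; cong; cong₂; subst; isEquivalence; _≢_)

module _ {n : ℕ} {P : Fin n → Set} (P? : Decidable P) where

  subsetOf : Subset n
  subsetOf = tabulate (does ∘ P?)

  ∈-subsetOf⁺ : ∀ {x} → P x → x ∈ subsetOf
  ∈-subsetOf⁺ {x} px = lookup⇒[]= x subsetOf (trans (lookup∘tabulate _ x) (dec-true (P? x) px))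

  ∈-subsetOf⁻ : ∀ {x} → x ∈ subsetOf → P x
  ∈-subsetOf⁻ {x} x∈ with P? x | trans (sym (lookup∘tabulate (does ∘ P?) x)) ([]=⇒lookup x∈)
  ... | yes px | _ = px
  ... | no _   | ()

-- A subset admitting an injective map into Fin k has at most k elements.
-- The map may use the membership proof, which is how preimages get chosen.
∣p∣≤-injection : ∀ {n k} (p : Subset n) (f : ∀ x → x ∈ p → Fin k)
  → (∀ x y x∈p y∈p → f x x∈p ≡ f y y∈p → x ≡ y) → ∣ p ∣ ≤ k
∣p∣≤-injection [] f f-inj = z≤n
∣p∣≤-injection (outside ∷ p) f f-inj =
  ∣p∣≤-injection p (λ x x∈p → f (fsuc x) (there x∈p))
    (λ x y x∈p y∈p eq → suc-injective (f-inj _ _ _ _ eq))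
∣p∣≤-injection {k = zero} (inside ∷ p) f f-inj with f fzero here
... | ()
∣p∣≤-injection {k = suc k} (inside ∷ p) f f-inj =
  s≤s (∣p∣≤-injection p f′ (λ x y x∈p y∈p eq →
    suc-injective (f-inj _ _ _ _ (punchOut-injective (distinct x∈p) (distinct y∈p) eq))))
  where
  -- the image of the head element is never hit by the tail, so the tail
  -- maps injectively into the k remaining values
  distinct : ∀ {x} (x∈p : x ∈ p) → f fzero here ≢ f (fsuc x) (there x∈p)
  distinct x∈p eq = 0≢1+n (f-inj _ _ _ _ eq)
  f′ : ∀ x → x ∈ p → Fin k
  f′ x x∈p = punchOut (distinct x∈p)

crossing : ∀ {P Q : ℕ → Set} s → (∀ j → Q j ⊎ P j) → P 0 → ¬ P s
  → ∃ λ j → j < s × P j × Q (suc j)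
crossing zero Q-or-P p₀ ¬pₛ = ⊥-elim (¬pₛ p₀)
crossing (suc s) Q-or-P p₀ ¬pₛ with Q-or-P 1
... | inj₁ q₁ = 0 , s≤s z≤n , p₀ , q₁
... | inj₂ p₁ with crossing s (Q-or-P ∘ suc) p₁ ¬pₛ
...   | j , j<s , pⱼ , qⱼ₊₁ = suc j , s≤s j<s , pⱼ , qⱼ₊₁

asGroup : FinGroup → Group 0ℓ 0ℓ
asGroup K = record
  { _≈_ = _≡_
  ; _∙_ = _∙_
  ; ε = ε
  ; _⁻¹ = _⁻¹
  ; isGroup = record
    { isMonoid = record
      { isSemigroup = record
        { isMagma = record { isEquivalence = isEquivalence ; ∙-cong = cong₂ _∙_ }
        ; assoc = assoc
        }
      ; identity = identityˡ , identityʳ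
      }
    ; inverse = inverseˡ , inverseʳ
    ; ⁻¹-cong = cong _⁻¹
    }
  }
  where open FinGroup K

module GroupLaws (K : FinGroup) = Algebra.Properties.Group (asGroup K)

module HomLaws {H K : FinGroup} {f : Carrier H → Carrier K} (f-hom : IsHom H K f) where
  private
    module H = FinGroup H
  open FinGroup K hiding (order; Carrier)
  open GroupLaws K

  hom-ε : f H.ε ≡ ε
  hom-ε = identityˡ-unique (f H.ε) (f H.ε)
    (trans (sym (f-hom H.ε H.ε)) (cong f (H.identityˡ H.ε)))

  hom-⁻¹ : ∀ x → f (x H.⁻¹) ≡ f x ⁻¹
  hom-⁻¹ x = inverseˡ-unique (f (x H.⁻¹)) (f x)
    (trans (sym (f-hom (x H.⁻¹) x)) (trans (cong f (H.inverseˡ x)) hom-ε))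

  hom-difference : ∀ x y → f (x H.∙ (y H.⁻¹)) ≡ f x ∙ (f y ⁻¹)
  hom-difference x y = trans (f-hom x (y H.⁻¹)) (cong (f x ∙_) (hom-⁻¹ y))

  hom-conj : ∀ g x → f ((g H.∙ x) H.∙ (g H.⁻¹)) ≡ (f g ∙ f x) ∙ (f g ⁻¹)
  hom-conj g x = trans (f-hom _ _) (cong₂ _∙_ (f-hom g x) (hom-⁻¹ g))

  equal⇒difference-killed : ∀ {x y} → f x ≡ f y → f (x H.∙ (y H.⁻¹)) ≡ ε
  equal⇒difference-killed {x} {y} eq = trans (hom-difference x y) (x≈y⇒x∙y⁻¹≈ε eq)

  difference-killed⇒equal : ∀ {x y} → f (x H.∙ (y H.⁻¹)) ≡ ε → f x ≡ f y
  difference-killed⇒equal {x} {y} eq =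
    x∙y⁻¹≈ε⇒x≈y (f x) (f y) (trans (sym (hom-difference x y)) eq)

-- Normal subgroups presented as (not necessarily decidable) predicates;
-- this is the form in which kernels, preimages and intersections arise.
module _ (K : FinGroup) where
  open FinGroup K hiding (order; Carrier)

  record IsNormal (P : Carrier K → Set) : Set where
    field
      ε-closed    : P ε
      ∙-closed    : ∀ {x y} → P x → P y → P (x ∙ y)
      ⁻¹-closed   : ∀ {x} → P x → P (x ⁻¹)
      conj-closed : ∀ g {x} → P x → P ((g ∙ x) ∙ (g ⁻¹))

    difference-closed : ∀ {x y} → P x → P y → P (x ∙ (y ⁻¹))
    difference-closed px py = ∙-closed px (⁻¹-closed py)

  open IsNormal

  fromNormalSubgroup : ∀ {S} → IsNormalSubgroup K S → IsNormal (_∈ S)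
  fromNormalSubgroup ((ε∈ , ∙∈ , ⁻¹∈) , conj∈) =
    record { ε-closed = ε∈ ; ∙-closed = ∙∈ _ _ ; ⁻¹-closed = ⁻¹∈ _ ; conj-closed = λ g → conj∈ g _ }

  toNormalSubgroup : ∀ {S} → IsNormal (_∈ S) → IsNormalSubgroup K S
  toNormalSubgroup N =
    (ε-closed N , (λ _ _ → ∙-closed N) , (λ _ → ⁻¹-closed N)) , (λ g _ → conj-closed N g)

  trivial-normal : IsNormal (_≡ ε)
  trivial-normal = record
    { ε-closed = refl
    ; ∙-closed = λ { refl refl → identityˡ ε }
    ; ⁻¹-closed = λ { refl → ε⁻¹≈ε }
    ; conj-closed = λ { g refl → trans (cong (_∙ (g ⁻¹)) (identityʳ g)) (inverseʳ g) }
    }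
    where open GroupLaws K using (ε⁻¹≈ε)

  ⋂-normal : {I : Set} (Q : I → Set) {P : I → Carrier K → Set}
    → (∀ i → IsNormal (P i)) → IsNormal (λ x → ∀ i → Q i → P i x)
  ⋂-normal Q N = record
    { ε-closed = λ i _ → ε-closed (N i)
    ; ∙-closed = λ px py i q → ∙-closed (N i) (px i q) (py i q)
    ; ⁻¹-closed = λ px i q → ⁻¹-closed (N i) (px i q)
    ; conj-closed = λ g px i q → conj-closed (N i) g (px i q)
    }

  ∩-normal : ∀ {P Q} → IsNormal P → IsNormal Q → IsNormal (λ x → P x × Q x)
  ∩-normal M N = record
    { ε-closed = ε-closed M , ε-closed N
    ; ∙-closed = λ (px , qx) (py , qy) → ∙-closed M px py , ∙-closed N qx qy
    ; ⁻¹-closed = λ (px , qx) → ⁻¹-closed M px , ⁻¹-closed N qx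
    ; conj-closed = λ g (px , qx) → conj-closed M g px , conj-closed N g qx
    }

open IsNormal

module _ {H K : FinGroup} {f : Carrier H → Carrier K} (f-hom : IsHom H K f) where
  open FinGroup K hiding (order; Carrier)
  open HomLaws {H} {K} {f} f-hom

  preimage-normal : ∀ {Q} → IsNormal K Q → IsNormal H (Q ∘ f)
  preimage-normal {Q} N = record
    { ε-closed = subst Q (sym hom-ε) (ε-closed N)
    ; ∙-closed = λ {x} {y} qx qy → subst Q (sym (f-hom x y)) (∙-closed N qx qy)
    ; ⁻¹-closed = λ {x} qx → subst Q (sym (hom-⁻¹ x)) (⁻¹-closed N qx)
    ; conj-closed = λ g {x} qx → subst Q (sym (hom-conj g x)) (conj-closed N (f g) qx)
    }

  kernel-normal : IsNormal H (λ x → f x ≡ ε)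
  kernel-normal = preimage-normal (trivial-normal K)

module _ {n m : ℕ} (f : Fin n → Fin m) {P : Fin n → Set} (P? : Decidable P) where

  image? : Decidable (λ g → ∃ λ x → P x × f x ≡ g)
  image? g = any? (λ x → P? x ×-dec (f x ≟ᶠ g))

  image : Subset m
  image = subsetOf image?

  image⁺ : ∀ {x} → P x → f x ∈ image
  image⁺ {x} px = ∈-subsetOf⁺ image? (x , px , refl)

  image⁻ : ∀ {g} → g ∈ image → ∃ λ x → P x × f x ≡ g
  image⁻ = ∈-subsetOf⁻ image?

module _ {H K : FinGroup} {f : Carrier H → Carrier K} (f-hom : IsHom H K f) (f-onto : Surjective f)
         {P : Carrier H → Set} (P? : Decidable P) where
  open FinGroup K hiding (order; Carrier)
  open HomLaws {H} {K} {f} f-hom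

  image-normal : IsNormal H P → IsNormal K (_∈ image f P?)
  image-normal N = record
    { ε-closed = subst (_∈ image f P?) hom-ε (image⁺ f P? (ε-closed N))
    ; ∙-closed = ∙-closed′
    ; ⁻¹-closed = ⁻¹-closed′
    ; conj-closed = conj-closed′
    }
    where
    ∙-closed′ : ∀ {g h} → g ∈ image f P? → h ∈ image f P? → (g ∙ h) ∈ image f P?
    ∙-closed′ g∈ h∈ with image⁻ f P? g∈ | image⁻ f P? h∈
    ... | x , px , refl | y , py , refl =
      subst (_∈ image f P?) (f-hom x y) (image⁺ f P? (∙-closed N px py))

    ⁻¹-closed′ : ∀ {g} → g ∈ image f P? → (g ⁻¹) ∈ image f P?
    ⁻¹-closed′ g∈ with image⁻ f P? g∈
    ... | x , px , refl = subst (_∈ image f P?) (hom-⁻¹ x) (image⁺ f P? (⁻¹-closed N px))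

    -- conjugating elements of K lift to H because f is onto
    conj-closed′ : ∀ g {h} → h ∈ image f P? → ((g ∙ h) ∙ (g ⁻¹)) ∈ image f P?
    conj-closed′ g h∈ with f-onto g | image⁻ f P? h∈
    ... | a , refl | x , px , refl =
      subst (_∈ image f P?) (hom-conj a x) (image⁺ f P? (conj-closed N a px))

module Layers (G : FinGroup) (W : Subset (order G)) (W-minimal : IsMinimalNormal G W)
    (s : ℕ) (Hs : Fin s → FinGroup) (H : FinGroup)
    (ι : (x : Carrier H) → (i : Fin s) → Carrier (Hs i)) (ι-embedding : IsEmbeddingIntoProduct H s Hs ι)
    (π : Carrier H → Carrier G) (π-hom : IsHom H G π) (π-onto : Surjective π) where

  private
    module H = FinGroup H
    ε[_] : (i : Fin s) → Carrier (Hs i)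
    ε[ i ] = FinGroup.ε (Hs i)

  W-normal : IsNormal G (_∈ W)
  W-normal = fromNormalSubgroup G (proj₁ W-minimal)

  K : ℕ → Carrier H → Set
  K j x = ∀ i → toℕ i < j → ι x i ≡ ε[ i ]

  K-normal : ∀ j → IsNormal H (K j)
  K-normal j = ⋂-normal H (λ i → toℕ i < j) (λ i → kernel-normal {H} {Hs i} (proj₁ ι-embedding i))

  K-step : ∀ {x} (i : Fin s) → K (toℕ i) x → ι x i ≡ ε[ i ] → K (suc (toℕ i)) x
  K-step i x∈Kᵢ ιᵢx≡ε i′ i′<1+i with m<1+n⇒m<n∨m≡n i′<1+i
  ... | inj₁ i′<i = x∈Kᵢ i′ i′<i
  ... | inj₂ i′≡i with toℕ-injective i′≡i
  ...   | refl = ιᵢx≡ε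

  Kₛ-trivial : ∀ {x} → K s x → x ≡ H.ε
  Kₛ-trivial {x} x∈Kₛ = proj₂ ι-embedding x H.ε
    (λ i → trans (x∈Kₛ i (toℕ<n i)) (sym (HomLaws.hom-ε {H} {Hs i} (proj₁ ι-embedding i))))

  L : ℕ → Carrier H → Set
  L j x = π x ∈ W × K j x

  L? : ∀ j → Decidable (L j)
  L? j x = (π x ∈? W) ×-dec all? (λ i → (toℕ i <? j) →-dec (ι x i ≟ᶠ ε[ i ]))

  L-normal : ∀ j → IsNormal H (L j)
  L-normal j = ∩-normal H (preimage-normal {H} {G} π-hom W-normal) (K-normal j)

  W[_] : ℕ → Subset (order G)
  W[ j ] = image π (L? j)

  W[j]⊆W : ∀ j → W[ j ] ⊆ W
  W[j]⊆W j g∈ with image⁻ π (L? j) g∈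
  ... | x , (πx∈W , _) , refl = πx∈W

  W[j]-trivial-or-full : ∀ j → IsTrivial G W[ j ] ⊎ W ⊆ W[ j ]
  W[j]-trivial-or-full j = proj₂ (proj₂ W-minimal) W[ j ]
    (toNormalSubgroup G (image-normal π-hom π-onto (L? j) (L-normal j))) (W[j]⊆W j)

  W⊆W[0] : W ⊆ W[ 0 ]
  W⊆W[0] {w} w∈W with π-onto w
  ... | x , refl = image⁺ π (L? 0) (w∈W , λ _ ())

  W⊈W[s] : ¬ (W ⊆ W[ s ])
  W⊈W[s] W⊆W[s] with proj₁ (proj₂ W-minimal)
  ... | w , w∈W , w≢ε with image⁻ π (L? s) (W⊆W[s] w∈W)
  ...   | x , (_ , x∈Kₛ) , refl =
    w≢ε (trans (cong π (Kₛ-trivial x∈Kₛ)) (HomLaws.hom-ε {H} {G} π-hom))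

  -- If W[j] = W and W[j+1] = 1, then W embeds into the j-th factor: two
  -- elements of the layer with the same j-th coordinate differ by an element
  -- of the next layer, which π kills.
  layer-separates : ∀ (i : Fin s) → IsTrivial G W[ suc (toℕ i) ]
    → ∀ {x y} → L (toℕ i) x → L (toℕ i) y → ι x i ≡ ι y i → π x ≡ π y
  layer-separates i W[i+1]-trivial {x} {y} x∈L y∈L ιᵢx≡ιᵢy =
    HomLaws.difference-killed⇒equal {H} {G} π-hom (W[i+1]-trivial _ (image⁺ π (L? _) d∈L))
    where
    d∈Lᵢ : L (toℕ i) (x H.∙ (y H.⁻¹))
    d∈Lᵢ = difference-closed (L-normal (toℕ i)) x∈L y∈L
    d∈L : L (suc (toℕ i)) (x H.∙ (y H.⁻¹))
    d∈L = proj₁ d∈Lᵢ , K-step i (proj₂ d∈Lᵢ)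
      (HomLaws.equal⇒difference-killed {H} {Hs i} (proj₁ ι-embedding i) ιᵢx≡ιᵢy)

  W-embeds : ∀ {j} (i : Fin s) → toℕ i ≡ j → W ⊆ W[ j ] → IsTrivial G W[ suc j ]
    → ∣ W ∣ ≤ order (Hs i)
  W-embeds i refl W⊆W[i] W[i+1]-trivial = ∣p∣≤-injection W code code-injective
    where
    lift : ∀ {w} → w ∈ W → ∃ λ x → L (toℕ i) x × π x ≡ w
    lift w∈W = image⁻ π (L? (toℕ i)) (W⊆W[i] w∈W)
    code : ∀ w → w ∈ W → Carrier (Hs i)
    code w w∈W = ι (proj₁ (lift w∈W)) i
    code-injective : ∀ w v w∈W v∈W → code w w∈W ≡ code v v∈W → w ≡ v
    code-injective w v w∈W v∈W eq with lift w∈W | lift v∈W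
    ... | x , x∈L , refl | y , y∈L , refl = layer-separates i W[i+1]-trivial x∈L y∈L eq

lemma3p2 : (G : FinGroup) (W : Subset (order G)) → IsMinimalNormal G W
    → (m : ℕ) → ∣ W ∣ ≡ m
    → (s : ℕ) (Hs : Fin s → FinGroup) (H : FinGroup)
    → (ι : (x : Carrier H) → (i : Fin s) → Carrier (Hs i)) → IsEmbeddingIntoProduct H s Hs ι
    → (π : Carrier H → Carrier G) → IsHom H G π → Surjective π
    → ∃ λ (i : Fin s) → m ≤ order (Hs i)
lemma3p2 G W W-minimal m refl s Hs H ι ι-embedding π π-hom π-onto =
  let j , j<s , W⊆W[j] , W[j+1]-trivial =
        crossing {λ j → W ⊆ W[ j ]} {λ j → IsTrivial G W[ j ]} s
          W[j]-trivial-or-full W⊆W[0] W⊈W[s]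
  in fromℕ< j<s , W-embeds (fromℕ< j<s) (toℕ-fromℕ< j<s) W⊆W[j] W[j+1]-trivial
  where open Layers G W W-minimal s Hs H ι ι-embedding π π-hom π-onto
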